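{- Let $G$ be a connected graph and $H$ a graph, both with at least two vertices. If at least one of $G$ and $H$ is not a complete graph, then $\chi_\mu(G\circ H)=2$.
   Context: All graphs are finite and simple. The lexicographic product $G\circ H$ has vertex set $V(G)\times V(H)$, with $(g,h)$ adjacent to $(g',h')$ iff $gg'\in E(G)$, or $g=g'$ and $hh'\in E(H)$. A geodesic is a shortest path. For $X\subseteq V(G)$, two vertices $x,y\in X$ are $X$-visible if some $x,y$-geodesic has no internal vertex in $X$; $X$ is a mutual-visibility (MV) set if every two of its vertices are $X$-visible. $\chi_\mu(G)$ is the least $k$ such that $V(G)$ can be partitioned into $k$ MV sets. -}

module Defs where

open import Data.Nat using (ℕ; zero; suc; _≤_; _<_)
open import Data.Fin using (Fin; toℕ; inject₁; remQuot; _≟_)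
import Data.Fin as F
open import Data.Bool using (Bool; true; false; _∧_; _∨_; T)
open import Data.Bool.Properties using (∨-comm)
open import Data.Product using (Σ; ∃; ∃-syntax; _×_; _,_; proj₁; proj₂)
open import Relation.Nullary using (¬_; Dec; yes; no; does)
open import Relation.Binary.PropositionalEquality using (_≡_; _≢_; refl; sym; cong; cong₂)

record Graph : Set where
  field
    n      : ℕ
    adj    : Fin n → Fin n → Bool
    adj-sym    : ∀ x y → adj x y ≡ adj y x
    adj-irrefl : ∀ x → adj x x ≡ false

open Graph public

V : Graph → Set
V G = Fin (n G)

Edge : (G : Graph) → V G → V G → Set
Edge G x y = T (adj G x y)

record Walk (G : Graph) (x y : V G) (k : ℕ) : Set where
  field
    vtx   : Fin (suc k) → V G
    start : vtx F.zero ≡ x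
    end   : vtx (F.fromℕ k) ≡ y
    step  : ∀ (i : Fin k) → Edge G (vtx (inject₁ i)) (vtx (F.suc i))

open Walk public

-- A geodesic: a walk from x to y of length k, no walk from x to y being shorter.
-- (A shortest walk is automatically a path.)
record Geodesic (G : Graph) (x y : V G) (k : ℕ) : Set where
  field
    walk     : Walk G x y k
    shortest : ∀ k' → Walk G x y k' → k ≤ k'

open Geodesic public

Internal : {k : ℕ} → Fin (suc k) → Set
Internal {k} i = (0 < toℕ i) × (toℕ i < k)

VSet : Graph → Set₁
VSet G = V G → Set

Visible : (G : Graph) → VSet G → V G → V G → Set
Visible G X x y =
  ∃[ k ] Σ (Geodesic G x y k) λ P →
    ∀ (i : Fin (suc k)) → Internal i → ¬ X (vtx (walk P) i)

IsMV : (G : Graph) → VSet G → Set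
IsMV G X = ∀ x y → X x → X y → Visible G X x y

MVPartition : Graph → ℕ → Set
MVPartition G k = Σ (V G → Fin k) λ c → ∀ (j : Fin k) → IsMV G (λ v → c v ≡ j)

ChiMu≡ : Graph → ℕ → Set
ChiMu≡ G k = MVPartition G k × (∀ m → m < k → ¬ MVPartition G m)

Connected : Graph → Set
Connected G = ∀ (x y : V G) → ∃[ k ] Walk G x y k

Complete : Graph → Set
Complete G = ∀ (x y : V G) → x ≢ y → Edge G x y

-- Lexicographic product G ∘ H on Fin (n G * n H); vertex i corresponds to the
-- pair remQuot (n H) i = (g , h) (a bijection, inverse Data.Fin.combine).
eqb : ∀ {m} → Fin m → Fin m → Bool
eqb a b = does (a ≟ b)

eqb-sym : ∀ {m} (a b : Fin m) → eqb a b ≡ eqb b a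
eqb-sym a b with a ≟ b | b ≟ a
... | yes _ | yes _ = refl
... | no _  | no _  = refl
... | yes p | no q  with q (sym p)
... | ()
eqb-sym a b | no q | yes p with q (sym p)
... | ()

eqb-refl : ∀ {m} (a : Fin m) → eqb a a ≡ true
eqb-refl a with a ≟ a
... | yes _ = refl
... | no q with q refl
... | ()

pairAdj : (G H : Graph) → V G × V H → V G × V H → Bool
pairAdj G H (g , h) (g' , h') = adj G g g' ∨ (eqb g g' ∧ adj H h h')

pairAdj-sym : (G H : Graph) → ∀ p q → pairAdj G H p q ≡ pairAdj G H q p
pairAdj-sym G H (g , h) (g' , h') =
  cong₂ _∨_ (adj-sym G g g') (cong₂ _∧_ (eqb-sym g g') (adj-sym H h h'))

pairAdj-irrefl : (G H : Graph) → ∀ p → pairAdj G H p p ≡ false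
pairAdj-irrefl G H (g , h)
  rewrite adj-irrefl G g | eqb-refl g | adj-irrefl H h = refl

lexPair : (G H : Graph) → Fin (n G Data.Nat.* n H) → V G × V H
lexPair G H i = remQuot {n G} (n H) i

_∘ₗ_ : Graph → Graph → Graph
G ∘ₗ H = record
  { n          = n G Data.Nat.* n H
  ; adj        = λ i j → pairAdj G H (lexPair G H i) (lexPair G H j)
  ; adj-sym    = λ i j → pairAdj-sym G H (lexPair G H i) (lexPair G H j)
  ; adj-irrefl = λ i → pairAdj-irrefl G H (lexPair G H i)
  }

{-# OPTIONS --safe #-}
-- Colour (g , h) by whether h is the first vertex of H. Each colour class then
-- misses a whole layer V(G) × {h₀}, and any set missing such a layer is a
-- mutual-visibility set: two vertices in different G-fibres are joined by a
-- geodesic of G lifted into the layer h₀ (it stays a geodesic because every walk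
-- of G ∘ H projects onto a walk of G that is no longer), and two non-adjacent
-- vertices of one fibre by a path of length 2 through a G-neighbour in that layer.
-- A single colour would make V(G ∘ H) itself a mutual-visibility set, which forces
-- G ∘ H, and hence both G and H, to be complete.
module Submission where

open import Defs
open import Data.Nat using (ℕ; zero; suc; _≤_; _<_; z≤n; s≤s)
open import Data.Nat.Properties using (≤-trans; ≮⇒≥; m≤n⇒m≤1+n; anyUpTo?)
open import Data.Nat.Induction using (<-rec)
open import Data.Fin using (Fin; inject₁; combine; fromℕ<; _≟_)
import Data.Fin as F
open import Data.Fin.Properties
  using (remQuot-combine; combine-injectiveˡ; combine-injectiveʳ; any?)
open import Data.Bool using (T)
open import Data.Bool.Properties using (T-∨; T-∧)
open import Data.Product using (Σ; ∃-syntax; _×_; _,_; proj₁; proj₂)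
open import Data.Sum using (_⊎_; inj₁; inj₂)
open import Data.Empty using (⊥-elim)
open import Function.Base using (_∘_)
open import Function.Bundles using (Equivalence)
open import Relation.Nullary using (¬_; Dec; yes; no)
open import Relation.Nullary.Decidable using (T?; _×-dec_)
open import Relation.Unary using (Pred; Decidable)
open import Relation.Binary.PropositionalEquality
  using (_≡_; _≢_; refl; sym; trans; cong; subst; subst₂)

open Equivalence using (to; from)

private
  variable
    G : Graph
    k : ℕ

edge-irrefl : {x : V G} → ¬ Edge G x x
edge-irrefl {G = G} {x = x} = subst T (adj-irrefl G x)

edge-sym : {x y : V G} → Edge G x y → Edge G y x
edge-sym {G = G} {x = x} {y = y} = subst T (adj-sym G x y)

eqb⇒≡ : ∀ {m} {a b : Fin m} → T (eqb a b) → a ≡ b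
eqb⇒≡ {a = a} {b} t with a ≟ b
... | yes a≡b = a≡b
... | no _    = ⊥-elim t

data Steps (G : Graph) : V G → V G → ℕ → Set where
  []  : ∀ {x} → Steps G x x 0
  _∷_ : ∀ {x y z k} → Edge G x z → Steps G z y k → Steps G x y (suc k)

fromWalk : {x y : V G} → Walk G x y k → Steps G x y k
fromWalk {G = G} {zero} {y = y} w =
  subst (λ a → Steps G a y 0) (start w) (subst (λ b → Steps G (vtx w F.zero) b 0) (end w) [])
fromWalk {G = G} {suc k} {y = y} w =
  subst (λ a → Edge G a (vtx w (F.suc F.zero))) (start w) (step w F.zero) ∷ fromWalk tail
  where
    tail : Walk G (vtx w (F.suc F.zero)) y k
    tail = record { vtx = λ i → vtx w (F.suc i) ; start = refl ; end = end w
                  ; step = λ i → step w (F.suc i) }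

Steps-0⇒≡ : {x y : V G} → Steps G x y 0 → x ≡ y
Steps-0⇒≡ [] = refl

Steps-1⇒Edge : {x y : V G} → Steps G x y 1 → Edge G x y
Steps-1⇒Edge (e ∷ []) = e

≢⇒1≤length : {x y : V G} → x ≢ y → Steps G x y k → 1 ≤ k
≢⇒1≤length x≢y []      = ⊥-elim (x≢y refl)
≢⇒1≤length x≢y (_ ∷ _) = s≤s z≤n

nonadjacent⇒2≤length : {x y : V G} → x ≢ y → ¬ Edge G x y → Steps G x y k → 2 ≤ k
nonadjacent⇒2≤length x≢y _  []            = ⊥-elim (x≢y refl)
nonadjacent⇒2≤length _   ¬e (e ∷ [])      = ⊥-elim (¬e e)
nonadjacent⇒2≤length _   _  (_ ∷ (_ ∷ _)) = s≤s (s≤s z≤n)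

Steps? : ∀ G k (x y : V G) → Dec (Steps G x y k)
Steps? G zero x y with x ≟ y
... | yes refl = yes []
... | no x≢y   = no λ w → x≢y (Steps-0⇒≡ w)
Steps? G (suc k) x y with any? (λ z → T? (adj G x z) ×-dec Steps? G k z y)
... | yes (_ , e , w) = yes (e ∷ w)
... | no none         = no λ { (e ∷ w) → none (_ , e , w) }

module _ {p} {P : Pred ℕ p} (P? : Decidable P) where

  least : ∀ k → P k → ∃[ m ] P m × (∀ {m′} → P m′ → m ≤ m′)
  least = <-rec _ search
    where
      search : ∀ k → (∀ {j} → j < k → P j → ∃[ m ] P m × (∀ {m′} → P m′ → m ≤ m′)) →
               P k → ∃[ m ] P m × (∀ {m′} → P m′ → m ≤ m′)
      search k smaller pk with anyUpTo? P? k
      ... | yes (j , j<k , pj) = smaller j<k pj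
      ... | no none            = k , pk , λ pm′ → ≮⇒≥ λ m′<k → none (_ , m′<k , pm′)

shortestSteps : {x y : V G} → Steps G x y k →
                ∃[ m ] Steps G x y m × (∀ {m′} → Steps G x y m′ → m ≤ m′)
shortestSteps {G = G} {x = x} {y} = least (λ m → Steps? G m x y) _

data StepsVia (G : Graph) (Q : VSet G) : V G → V G → ℕ → Set where
  edge : ∀ {x y} → Edge G x y → StepsVia G Q x y 1
  via  : ∀ {x y z k} → Edge G x z → Q z → StepsVia G Q z y k → StepsVia G Q x y (suc k)

toWalk : {Q : VSet G} {x y : V G} → StepsVia G Q x y k →
         Σ (Walk G x y k) λ P → ∀ i → Internal i → Q (vtx P i)
toWalk {G = G} {Q = Q} {x} {y} (edge e) =
  record { vtx = vt ; start = refl ; end = refl ; step = λ { F.zero → e } } , internal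
  where
    vt : Fin 2 → V G
    vt F.zero    = x
    vt (F.suc _) = y
    internal : ∀ i → Internal i → Q (vt i)
    internal F.zero         (() , _)
    internal (F.suc F.zero) (_ , s≤s ())
toWalk {G = G} {suc k} {Q} {x} (via e q rest) with toWalk rest
... | P , internalP =
  record { vtx = vt ; start = refl ; end = end P ; step = st } , internal
  where
    vt : Fin (suc (suc k)) → V G
    vt F.zero    = x
    vt (F.suc i) = vtx P i
    st : (i : Fin (suc k)) → Edge G (vt (inject₁ i)) (vt (F.suc i))
    st F.zero    = subst (Edge G x) (sym (start P)) e
    st (F.suc i) = step P i
    internal : ∀ i → Internal i → Q (vt i)
    internal F.zero            (() , _)
    internal (F.suc F.zero)    _             = subst Q (sym (start P)) q
    internal (F.suc (F.suc i)) (_ , s≤s i<k) = internalP (F.suc i) (s≤s z≤n , i<k)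

visible-refl : {X : VSet G} (x : V G) → Visible G X x x
visible-refl x = 0 , record { walk = record { vtx = λ _ → x ; start = refl ; end = refl ; step = λ () }
                            ; shortest = λ _ _ → z≤n }
                   , λ { _ (_ , ()) }

visible-via : {X Q : VSet G} {x y : V G} → (∀ v → Q v → ¬ X v) → StepsVia G Q x y k →
              (∀ {k′} → Steps G x y k′ → k ≤ k′) → Visible G X x y
visible-via Q∩X=∅ w shortest with toWalk w
... | P , internal = _ , record { walk = P ; shortest = λ _ w′ → shortest (fromWalk w′) }
                       , λ i i-internal → Q∩X=∅ _ (internal i i-internal)

IsMV-full⇒Complete : {X : VSet G} → (∀ v → X v) → IsMV G X → Complete G
IsMV-full⇒Complete {G = G} full mv x y x≢y with mv x y (full x) (full y)
... | zero , P , _             = ⊥-elim (x≢y (Steps-0⇒≡ (fromWalk (walk P))))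
... | suc zero , P , _         = Steps-1⇒Edge (fromWalk (walk P))
... | suc (suc _) , P , avoids = ⊥-elim (avoids (F.suc F.zero) (s≤s z≤n , s≤s (s≤s z≤n)) (full _))

distinct : ∀ {n} → 2 ≤ n → (x : Fin n) → ∃[ y ] x ≢ y
distinct (s≤s (s≤s z≤n)) F.zero    = F.suc F.zero , λ ()
distinct (s≤s (s≤s z≤n)) (F.suc _) = F.zero , λ ()

has-neighbour : Connected G → 2 ≤ n G → (x : V G) → ∃[ y ] Edge G x y
has-neighbour connected 2≤n x with distinct 2≤n x
... | y , x≢y with connected x y
... | _ , w with fromWalk w
... | []    = ⊥-elim (x≢y refl)
... | e ∷ _ = _ , e

module Lex (G H : Graph) where

  fst : V (G ∘ₗ H) → V G
  fst u = proj₁ (lexPair G H u)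

  snd : V (G ∘ₗ H) → V H
  snd u = proj₂ (lexPair G H u)

  pair : V G → V H → V (G ∘ₗ H)
  pair = combine

  fst-pair : ∀ g h → fst (pair g h) ≡ g
  fst-pair g h = cong proj₁ (remQuot-combine g h)

  snd-pair : ∀ g h → snd (pair g h) ≡ h
  snd-pair g h = cong proj₂ (remQuot-combine g h)

  Layer : V H → VSet (G ∘ₗ H)
  Layer h w = snd w ≡ h

  edge-fst : ∀ {u v} → Edge G (fst u) (fst v) → Edge (G ∘ₗ H) u v
  edge-fst e = from T-∨ (inj₁ e)

  edge-split : ∀ {u v} → Edge (G ∘ₗ H) u v →
               Edge G (fst u) (fst v) ⊎ (fst u ≡ fst v × Edge H (snd u) (snd v))
  edge-split e with to T-∨ e
  ... | inj₁ e-fst = inj₁ e-fst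
  ... | inj₂ e-snd with to T-∧ e-snd
  ...   | fst≡ , e-H = inj₂ (eqb⇒≡ fst≡ , e-H)

  project : ∀ {u v} → Steps (G ∘ₗ H) u v k → ∃[ m ] m ≤ k × Steps G (fst u) (fst v) m
  project []      = 0 , z≤n , []
  project {v = v} (e ∷ w) with project w | edge-split e
  ... | m , m≤k , w-G | inj₁ e-G        = suc m , s≤s m≤k , e-G ∷ w-G
  ... | m , m≤k , w-G | inj₂ (fst≡ , _) =
    m , m≤n⇒m≤1+n m≤k , subst (λ g → Steps G g (fst v) m) (sym fst≡) w-G

  lift : ∀ {g g′ u v} → Steps G g g′ (suc k) → (h : V H) → fst u ≡ g → fst v ≡ g′ →
         StepsVia (G ∘ₗ H) (Layer h) u v (suc k)
  lift (e ∷ [])           h refl refl = edge (edge-fst e)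
  lift {u = u} (e ∷ w@(_ ∷ _)) h refl refl =
    via (edge-fst (subst (Edge G (fst u)) (sym (fst-pair _ h)) e)) (snd-pair _ h)
        (lift w h (fst-pair _ h) refl)

  Complete-∘ₗ⇒Completeˡ : V H → Complete (G ∘ₗ H) → Complete G
  Complete-∘ₗ⇒Completeˡ h complete g g′ g≢g′
    with edge-split (complete (pair g h) (pair g′ h) (g≢g′ ∘ combine-injectiveˡ g h g′ h))
  ... | inj₁ e          = subst₂ (Edge G) (fst-pair g h) (fst-pair g′ h) e
  ... | inj₂ (fst≡ , _) = ⊥-elim (g≢g′ (subst₂ _≡_ (fst-pair g h) (fst-pair g′ h) fst≡))

  Complete-∘ₗ⇒Completeʳ : V G → Complete (G ∘ₗ H) → Complete H
  Complete-∘ₗ⇒Completeʳ g complete h h′ h≢h′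
    with edge-split (complete (pair g h) (pair g h′) (h≢h′ ∘ combine-injectiveʳ g h g h′))
  ... | inj₁ e       = ⊥-elim (edge-irrefl {G = G} (subst₂ (Edge G) (fst-pair g h) (fst-pair g h′) e))
  ... | inj₂ (_ , e) = subst₂ (Edge H) (snd-pair g h) (snd-pair g h′) e

module _ (G H : Graph) (connected : Connected G) (2≤|G| : 2 ≤ n G) where
  open Lex G H

  module _ {X : VSet (G ∘ₗ H)} (h : V H) (layer∩X=∅ : ∀ w → Layer h w → ¬ X w) where

    visible-across-fibres : ∀ {u v} → fst u ≢ fst v → Visible (G ∘ₗ H) X u v
    visible-across-fibres {u} {v} fst≢ with connected (fst u) (fst v)
    ... | _ , w with shortestSteps (fromWalk w)
    ... | zero , w₀ , _ = ⊥-elim (fst≢ (Steps-0⇒≡ w₀))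
    ... | suc _ , geodesic , minimal =
      visible-via layer∩X=∅ (lift geodesic h refl refl) λ w′ →
        let _ , m′≤k′ , w′-G = project w′ in ≤-trans (minimal w′-G) m′≤k′

    visible-within-fibre : ∀ {u v} → fst u ≡ fst v → Visible (G ∘ₗ H) X u v
    visible-within-fibre {u} {v} fst≡ with u ≟ v
    ... | yes refl = visible-refl {X = X} u
    ... | no u≢v with T? (adj (G ∘ₗ H) u v)
    ...   | yes e = visible-via layer∩X=∅ (edge e) (≢⇒1≤length u≢v)
    ...   | no ¬e with has-neighbour connected 2≤|G| (fst u)
    ...     | g , e-G =
      visible-via layer∩X=∅ (via u→gh (snd-pair g h) (edge gh→v)) (nonadjacent⇒2≤length u≢v ¬e)
      where
        u→gh : Edge (G ∘ₗ H) u (pair g h)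
        u→gh = edge-fst (subst (Edge G (fst u)) (sym (fst-pair g h)) e-G)
        gh→v : Edge (G ∘ₗ H) (pair g h) v
        gh→v = edge-fst (subst₂ (Edge G) (sym (fst-pair g h)) fst≡ (edge-sym {G = G} e-G))

    layer-free⇒IsMV : IsMV (G ∘ₗ H) X
    layer-free⇒IsMV u v _ _ with fst u ≟ fst v
    ... | yes fst≡ = visible-within-fibre fst≡
    ... | no fst≢  = visible-across-fibres fst≢

layerColour : ∀ {n} → Fin n → Fin 2
layerColour F.zero    = F.zero
layerColour (F.suc _) = F.suc F.zero

layerColour-avoids : ∀ {n} → 2 ≤ n → (j : Fin 2) → Σ (Fin n) λ h → layerColour h ≢ j
layerColour-avoids (s≤s (s≤s z≤n)) F.zero         = F.suc F.zero , λ ()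
layerColour-avoids (s≤s (s≤s z≤n)) (F.suc F.zero) = F.zero , λ ()

MVPartition-∘ₗ : (G H : Graph) → Connected G → 2 ≤ n G → 2 ≤ n H → MVPartition (G ∘ₗ H) 2
MVPartition-∘ₗ G H connected 2≤|G| 2≤|H| = layerColour ∘ snd , colourClass-IsMV
  where
    open Lex G H
    colourClass-IsMV : (j : Fin 2) → IsMV (G ∘ₗ H) (λ w → layerColour (snd w) ≡ j)
    colourClass-IsMV j with layerColour-avoids 2≤|H| j
    ... | h , colour≢j = layer-free⇒IsMV G H connected 2≤|G| h λ w w∈layer colour≡j →
      colour≢j (trans (cong layerColour (sym w∈layer)) colour≡j)

¬MVPartition-0 : V G → ¬ MVPartition G 0
¬MVPartition-0 x (c , _) with c x
... | ()

MVPartition-1⇒Complete : MVPartition G 1 → Complete G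
MVPartition-1⇒Complete (c , mv) = IsMV-full⇒Complete (λ v → Fin1-unique (c v)) (mv F.zero)
  where
    Fin1-unique : (i : Fin 1) → i ≡ F.zero
    Fin1-unique F.zero = refl

theorem4p12 : (G H : Graph) → Connected G → 2 ≤ n G → 2 ≤ n H →
    ¬ (Complete G × Complete H) → ChiMu≡ (G ∘ₗ H) 2
theorem4p12 G H connected 2≤|G| 2≤|H| ¬complete =
  MVPartition-∘ₗ G H connected 2≤|G| 2≤|H| , fewer
  where
    open Lex G H
    g : V G
    g = fromℕ< 2≤|G|
    h : V H
    h = fromℕ< 2≤|H|
    fewer : ∀ m → m < 2 → ¬ MVPartition (G ∘ₗ H) m
    fewer zero          _ = ¬MVPartition-0 (pair g h)
    fewer (suc zero)    _ partition =
      let complete = MVPartition-1⇒Complete partition in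
      ¬complete (Complete-∘ₗ⇒Completeˡ h complete , Complete-∘ₗ⇒Completeʳ g complete)
    fewer (suc (suc _)) (s≤s (s≤s ()))
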